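{- Let $\Sigma$ be a finite nonempty alphabet, let $m, n$ be integers with $0 < m < n < 2m$, and let $S \subseteq \Sigma^m \cup \Sigma^n$ be such that $S^*$ is co-finite. Let $\tau \in \Sigma^*$ be a word with $\tau \notin S^*$ and $|\tau| = n + jm$ for some integer $j \ge 0$. Then for every integer $i$ with $1 \le i < m$, $$S^* \cap (\tau \Sigma^m)^{i-1}\tau = \emptyset.$$
   Context: $\Sigma^m$ denotes the set of words of length exactly $m$ over $\Sigma$; $(\tau\Sigma^m)^{i-1}\tau$ is the set of words $\tau u_1 \tau u_2 \cdots \tau u_{i-1} \tau$ with all $u_h \in \Sigma^m$. A language $L \subseteq \Sigma^*$ is co-finite if $\Sigma^* \setminus L$ is finite. -}

module Defs where

open import Data.Nat using (ℕ)
open import Data.Fin using (Fin)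
open import Data.List using (List; []; _++_; length; concatMap)
open import Data.List.Membership.Propositional using (_∈_)
open import Data.Product using (∃)
open import Relation.Nullary using (¬_)
open import Relation.Binary.PropositionalEquality using (_≡_)
open import Data.Sum using (_⊎_)

Word : ℕ → Set
Word k = List (Fin k)

Lang : ℕ → Set₁
Lang k = Word k → Set

⊆ΣmΣn : ∀ {k} → ℕ → ℕ → Lang k → Set
⊆ΣmΣn m n S = ∀ w → S w → length w ≡ m ⊎ length w ≡ n

data Star {k : ℕ} (S : Lang k) : Lang k where
  ε   : Star S []
  _·_ : ∀ {u w} → S u → Star S w → Star S (u ++ w)

CoFinite : ∀ {k} → Lang k → Set
CoFinite {k} L = ∃ λ (F : List (Word k)) → ∀ w → ¬ L w → w ∈ F

-- τ u₁ τ u₂ ⋯ τ u_r τ for a list us = u₁ … u_r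
interleave : ∀ {k} → Word k → List (Word k) → Word k
interleave τ us = τ ++ concatMap (λ u → u ++ τ) us

module Submission where

-- Co-finiteness of S* forces gcd(m, n) = 1 and Σᵐ ⊆ S: otherwise some arbitrarily long words (of
-- length 1 modulo a common divisor, resp. x (y x)ᴺ with x ∈ Σᵐ ∖ S) all lie outside S*. Now factor
-- W = τ u₁ τ ⋯ u_{i-1} τ ∈ S* from the left. As |W| = i n + (i j + i - 1) m with i < m, coprimality
-- forces at least i factors of length n. A factor of length n that starts at offset q m ≤ j m of a
-- copy of τ lies inside it, and otherwise it pushes the next such factor past the next copy of τ;
-- so among the first i of them one splits τ = a b c with b ∈ S and m dividing |a| and |c|. Hence
-- τ ∈ S*.

open import Defs
open import Data.Nat using (ℕ; suc; zero; _+_; _*_; _<_; _≤_; _∸_; z≤n; s≤s; _≤?_; _≟_; >-nonZero)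
open import Data.Nat.Properties
open import Data.Nat.Divisibility using (_∣_; divides; ∣⇒≤; ∣1⇒≡1; ∣-trans; ∣m∣n⇒∣m+n; ∣m+n∣m⇒∣n; n∣m*n)
open import Data.Nat.Coprimality using (Coprime; coprime-divisor)
open import Data.Nat.Tactic.RingSolver using (solve-∀)
open import Data.Fin using (Fin)
open import Data.List using (List; length; []; _∷_; _++_; take; drop; replicate; concat; map)
open import Data.List.Properties using (++-assoc; ++-identityʳ; ++-conicalˡ; length-++; length-take; length-drop; length-replicate; take++drop≡id; ∷-injective)
open import Data.List.Extrema.Nat using (max; xs≤max)
open import Data.List.Membership.Propositional.Properties using (∈-map⁺)
import Data.List.Relation.Unary.All as All
open All using (All; []; _∷_)
open import Data.Product using (∃; ∃₂; _,_; _×_; proj₁; proj₂)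
open import Data.Sum using (inj₁; inj₂)
open import Effect.Monad using (RawMonad)
import Level
open import Function using (_∘_)
open import Relation.Nullary using (¬_; yes; no; contradiction)
open import Relation.Nullary.Decidable using (decidable-stable)
open import Relation.Nullary.Negation using (¬¬-Monad; ¬¬-map)
open import Relation.Binary.PropositionalEquality

open RawMonad (¬¬-Monad {Level.zero}) using (_>>=_; pure)

private variable
  A : Set
  k : ℕ

++-injective : ∀ (xs : List A) {ys zs ws} → length xs ≡ length zs →
  xs ++ ys ≡ zs ++ ws → xs ≡ zs × ys ≡ ws
++-injective [] {zs = []} _ eq = refl , eq
++-injective (x ∷ xs) {zs = z ∷ zs} len eq with ∷-injective eq
... | refl , eq′ with ++-injective xs {zs = zs} (suc-injective len) eq′
...   | refl , ys≡ws = refl , ys≡ws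

++-equidivisible : ∀ (xs : List A) {ys zs ws} → length xs ≤ length zs →
  xs ++ ys ≡ zs ++ ws → ∃ λ mid → zs ≡ xs ++ mid × ys ≡ mid ++ ws
++-equidivisible [] {zs = zs} _ refl = zs , refl , refl
++-equidivisible (x ∷ xs) {zs = z ∷ zs} (s≤s le) eq with ∷-injective eq
... | refl , eq′ with ++-equidivisible xs {zs = zs} le eq′
...   | mid , refl , refl = mid , refl , refl

length-concat-replicate : ∀ N (v : List A) → length (concat (replicate N v)) ≡ N * length v
length-concat-replicate zero    v = refl
length-concat-replicate (suc N) v =
  trans (length-++ v) (cong (length v +_) (length-concat-replicate N v))

Star-++ : ∀ {S : Lang k} {u v} → Star S u → Star S v → Star S (u ++ v)
Star-++ ε sv = sv
Star-++ {S = S} {v = v} (_·_ {u} {w} su sw) sv =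
  subst (Star S) (sym (++-assoc u w v)) (su · Star-++ sw sv)

Star-length-∣ : ∀ {S : Lang k} {d v} → (∀ {u} → S u → d ∣ length u) → Star S v → d ∣ length v
Star-length-∣ d∣S ε = divides 0 refl
Star-length-∣ d∣S (_·_ {u} su sw) =
  subst (_ ∣_) (sym (length-++ u)) (∣m∣n⇒∣m+n (d∣S su) (Star-length-∣ d∣S sw))

CoFinite-¬¬long : ∀ {L : Lang k} → CoFinite L → ∃ λ B → ∀ w → B < length w → ¬ ¬ L w
CoFinite-¬¬long (F , F⊇∁L) = max 0 (map length F) , λ w B<|w| w∉L →
  <⇒≱ B<|w| (All.lookup (xs≤max 0 (map length F)) (∈-map⁺ length (F⊇∁L w w∉L)))

coprime-coefficient-≤ : ∀ {m n r s i c} → Coprime m n → i < m →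
  r * n + s * m ≡ i * n + c * m → i ≤ r
coprime-coefficient-≤ {m} {n} {r} {s} {i} {c} coprime i<m eq with i ≤? r
... | yes i≤r = i≤r
... | no i≰r with m≤n⇒∃[o]m+o≡n (≰⇒> i≰r)
...   | o , refl = contradiction (≤-trans (∣⇒≤ m∣1+o) (s≤s (m≤n+m o r))) (<⇒≱ i<m)
  where
  sm≡ : s * m ≡ c * m + suc o * n
  sm≡ = +-cancelˡ-≡ (r * n) (s * m) (c * m + suc o * n) (trans eq (regroup r o n c m))
    where
    regroup : ∀ r o n c m → (suc r + o) * n + c * m ≡ r * n + (c * m + suc o * n)
    regroup = solve-∀
  m∣1+o : m ∣ suc o
  m∣1+o = coprime-divisor coprime (subst (m ∣_) (*-comm (suc o) n)
    (∣m+n∣m⇒∣n (subst (m ∣_) sm≡ (n∣m*n s)) (n∣m*n c)))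

few-long-factors : ∀ {m n j i r s} → 0 < m → r * suc j ≤ s →
  r * n + s * m ≤ i * (n + j * m + m) + (n + j * m) → r ≤ i
few-long-factors {m} {n} {j} {i} {r} {s} 0<m r[1+j]≤s bound with r ≤? i
... | yes r≤i = r≤i
... | no r≰i = contradiction T<T (<-irrefl refl)
  where
  open ≤-Reasoning
  i<r = ≰⇒> r≰i
  T = i * (n + j * m + m) + (n + j * m)
  regroup : ∀ i n j m → i * (n + j * m + m) + (n + j * m) + m ≡ suc i * n + suc i * suc j * m
  regroup = solve-∀
  T<T : T < T
  T<T = begin-strict
    T                                  <⟨ m<m+n T 0<m ⟩
    T + m                              ≡⟨ regroup i n j m ⟩
    suc i * n + suc i * suc j * m      ≤⟨ +-mono-≤ (*-monoˡ-≤ n i<r) (*-monoˡ-≤ m (*-monoˡ-≤ (suc j) i<r)) ⟩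
    r * n + r * suc j * m              ≤⟨ +-monoʳ-≤ (r * n) (*-monoˡ-≤ m r[1+j]≤s) ⟩
    r * n + s * m                      ≤⟨ bound ⟩
    T                                  ∎

module CoFiniteStar {S : Lang k} {m n : ℕ} (0<m : 0 < m) (m<n : m < n)
  (S⊆ΣᵐΣⁿ : ⊆ΣmΣn m n S) (S*-coFinite : CoFinite (Star S)) (letter : Fin k) where

  private
    bound : ℕ
    bound = proj₁ (CoFinite-¬¬long S*-coFinite)

    long∈S* : ∀ w → bound < length w → ¬ ¬ Star S w
    long∈S* = proj₂ (CoFinite-¬¬long S*-coFinite)

  coprime : Coprime m n
  coprime {d} (d∣m , d∣n) = decidable-stable (d ≟ 1) (¬¬-map (∣1⇒≡1 ∘ d∣1) (long∈S* w bound<|w|))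
    where
    w : Word k
    w = replicate (suc (bound * m)) letter
    bound<|w| : bound < length w
    bound<|w| = subst (bound <_) (sym (length-replicate (suc (bound * m))))
      (s≤s (m≤m*n bound m {{>-nonZero 0<m}}))
    d∣S : ∀ {u} → S u → d ∣ length u
    d∣S {u} su with S⊆ΣᵐΣⁿ u su
    ... | inj₁ |u|≡m = subst (d ∣_) (sym |u|≡m) d∣m
    ... | inj₂ |u|≡n = subst (d ∣_) (sym |u|≡n) d∣n
    d∣1 : Star S w → d ∣ 1
    d∣1 w∈S* = ∣m+n∣m⇒∣n
      (subst (d ∣_) (trans (length-replicate (suc (bound * m))) (+-comm 1 (bound * m))) (Star-length-∣ d∣S w∈S*))
      (∣-trans d∣m (n∣m*n bound))

  -- If x ∉ S, the words x (y x)ᴺ with |x y| = n admit only the factorisation x y · x y ⋯ x y · x.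
  Σᵐ⊆S : ∀ {x} → length x ≡ m → ¬ ¬ S x
  Σᵐ⊆S {x} |x|≡m = ¬¬-map (forced bound refl) (long∈S* (x ++ concat (replicate bound (y ++ x))) bound<)
    where
    y : Word k
    y = replicate (n ∸ m) letter
    |xy|≡n : length (x ++ y) ≡ n
    |xy|≡n = trans (length-++ x) (trans (cong₂ _+_ |x|≡m (length-replicate (n ∸ m))) (m+[n∸m]≡n (<⇒≤ m<n)))
    bound< : bound < length (x ++ concat (replicate bound (y ++ x)))
    bound< = begin-strict
      bound                                            ≤⟨ m≤m*n bound (length (y ++ x)) {{>-nonZero 0<|yx|}} ⟩
      bound * length (y ++ x)                          ≡⟨ sym (length-concat-replicate bound (y ++ x)) ⟩
      length (concat (replicate bound (y ++ x)))       <⟨ m<n+m _ 0<|x| ⟩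
      length x + length (concat (replicate bound (y ++ x))) ≡⟨ sym (length-++ x) ⟩
      length (x ++ concat (replicate bound (y ++ x)))  ∎
      where
      open ≤-Reasoning
      0<|x| : 0 < length x
      0<|x| = subst (0 <_) (sym |x|≡m) 0<m
      0<|yx| : 0 < length (y ++ x)
      0<|yx| = subst (0 <_) (sym (length-++ y)) (<-≤-trans 0<|x| (m≤n+m (length x) (length y)))
    forced : ∀ N {v} → v ≡ x ++ concat (replicate N (y ++ x)) → Star S v → S x
    forced N eq ε = contradiction (trans (sym |x|≡m) (cong length (++-conicalˡ x _ (sym eq)))) (<⇒≢ 0<m ∘ sym)
    forced N eq (_·_ {u} {w} su sw) with S⊆ΣᵐΣⁿ u su
    ... | inj₁ |u|≡m = subst S (proj₁ (++-injective u (trans |u|≡m (sym |x|≡m)) eq)) su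
    forced zero eq (_·_ {u} {w} su sw) | inj₂ |u|≡n = contradiction n≤m (<⇒≱ m<n)
      where
      open ≤-Reasoning
      n≤m : n ≤ m
      n≤m = begin
        n                   ≡⟨ sym |u|≡n ⟩
        length u            ≤⟨ m≤m+n (length u) (length w) ⟩
        length u + length w ≡⟨ sym (length-++ u) ⟩
        length (u ++ w)     ≡⟨ cong length eq ⟩
        length (x ++ [])    ≡⟨ cong length (++-identityʳ x) ⟩
        length x            ≡⟨ |x|≡m ⟩
        m                   ∎
    forced (suc N) eq (_·_ {u} {w} su sw) | inj₂ |u|≡n =
      forced N (proj₂ (++-injective u {zs = x ++ y} (trans |u|≡n (sym |xy|≡n)) (trans eq regroup))) sw
      where
      rest = concat (replicate N (y ++ x))
      regroup : x ++ (y ++ x) ++ rest ≡ (x ++ y) ++ x ++ rest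
      regroup = trans (cong (x ++_) (++-assoc y x rest)) (sym (++-assoc x y (x ++ rest)))

  Σᵐ*⊆S* : ∀ {v} → m ∣ length v → ¬ ¬ Star S v
  Σᵐ*⊆S* {v} (divides c |v|≡cm) = multiple c v |v|≡cm
    where
    multiple : ∀ c v → length v ≡ c * m → ¬ ¬ Star S v
    multiple zero    []      _ = pure ε
    multiple (suc c) v |v|≡ = do
      x∈S ← Σᵐ⊆S |take|
      rest∈S* ← multiple c (drop m v) |drop|
      pure (subst (Star S) (take++drop≡id m v) (x∈S · rest∈S*))
      where
      |take| : length (take m v) ≡ m
      |take| = trans (length-take m v) (m≤n⇒m⊓n≡m (subst (m ≤_) (sym |v|≡) (m≤m+n m (c * m))))
      |drop| : length (drop m v) ≡ c * m
      |drop| = trans (length-drop m v) (trans (cong (_∸ m) |v|≡) (m+n∸m≡n m (c * m)))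

AlignedFactor : Lang k → ℕ → Word k → Set
AlignedFactor S m τ = ∃₂ λ a c → ∃ λ b → τ ≡ a ++ b ++ c × m ∣ length a × S b × m ∣ length c

aligned-factor : ∀ {S : Lang k} {m n j q} {τ post a u w : Word k} →
  length τ ≡ n + j * m → length a ≡ q * m → q ≤ j → length u ≡ n → S u →
  τ ++ post ≡ a ++ u ++ w → AlignedFactor S m τ
aligned-factor {m = m} {n} {j} {q} {τ} {a = a} {u} {w} |τ| |a| q≤j |u| su eq =
  let c , τ≡auc , _ = ++-equidivisible (a ++ u) au≤τ (trans (++-assoc a u w) (sym eq))
  in a , c , u , trans τ≡auc (++-assoc a u c) , divides q |a| , su , m∣c τ≡auc
  where
  open ≤-Reasoning
  |au| : length (a ++ u) ≡ q * m + n
  |au| = trans (length-++ a) (cong₂ _+_ |a| |u|)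
  au≤τ : length (a ++ u) ≤ length τ
  au≤τ = begin
    length (a ++ u) ≡⟨ |au| ⟩
    q * m + n       ≤⟨ +-monoˡ-≤ n (*-monoˡ-≤ m q≤j) ⟩
    j * m + n       ≡⟨ +-comm (j * m) n ⟩
    n + j * m       ≡⟨ sym |τ| ⟩
    length τ        ∎
  m∣c : ∀ {c} → τ ≡ (a ++ u) ++ c → m ∣ length c
  m∣c {c} τ≡auc = ∣m+n∣m⇒∣n (subst (m ∣_) (sym qm+|c|≡jm) (n∣m*n j)) (n∣m*n q)
    where
    qm+|c|≡jm : q * m + length c ≡ j * m
    qm+|c|≡jm = +-cancelˡ-≡ n _ _ (begin-equality
      n + (q * m + length c)      ≡⟨ regroup n (q * m) (length c) ⟩
      (q * m + n) + length c      ≡⟨ cong (_+ length c) (sym |au|) ⟩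
      length (a ++ u) + length c  ≡⟨ sym (length-++ (a ++ u)) ⟩
      length ((a ++ u) ++ c)      ≡⟨ cong length (sym τ≡auc) ⟩
      length τ                    ≡⟨ |τ| ⟩
      n + j * m                   ∎)
      where
      regroup : ∀ n qm c → n + (qm + c) ≡ (qm + n) + c
      regroup = solve-∀

length-τu : ∀ {m} (τ : Word k) {u} → length u ≡ m → length (τ ++ u) ≡ length τ + m
length-τu τ |u|≡m = trans (length-++ τ) (cong (length τ +_) |u|≡m)

interleave-∷ : ∀ (τ u : Word k) us → interleave τ (u ∷ us) ≡ (τ ++ u) ++ interleave τ us
interleave-∷ τ u us = trans (cong (τ ++_) (++-assoc u τ _)) (sym (++-assoc τ u _))

length-interleave : ∀ {m} (τ : Word k) {us} → All (λ u → length u ≡ m) us →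
  length (interleave τ us) ≡ length us * (length τ + m) + length τ
length-interleave τ [] = cong length (++-identityʳ τ)
length-interleave {m = m} τ {u ∷ us} (|u|≡m ∷ |us|≡m) = begin
  length (interleave τ (u ∷ us))                            ≡⟨ cong length (interleave-∷ τ u us) ⟩
  length ((τ ++ u) ++ interleave τ us)                      ≡⟨ length-++ (τ ++ u) ⟩
  length (τ ++ u) + length (interleave τ us)                ≡⟨ cong₂ _+_ (length-τu τ |u|≡m) (length-interleave τ |us|≡m) ⟩
  (length τ + m) + (length us * (length τ + m) + length τ)  ≡⟨ sym (+-assoc (length τ + m) _ (length τ)) ⟩
  suc (length us) * (length τ + m) + length τ               ∎
  where open ≡-Reasoning

interleave-occurrence : ∀ {m} (τ : Word k) {us} r → r ≤ length us → All (λ u → length u ≡ m) us →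
  ∃₂ λ pre post → interleave τ us ≡ pre ++ τ ++ post × length pre ≡ r * (length τ + m)
interleave-occurrence τ zero _ _ = [] , _ , refl , refl
interleave-occurrence τ {u ∷ us} (suc r) (s≤s r≤|us|) (|u|≡m ∷ |us|≡m)
  with interleave-occurrence τ r r≤|us| |us|≡m
... | pre , post , eq , |pre| =
  (τ ++ u) ++ pre , post ,
  trans (interleave-∷ τ u us) (trans (cong ((τ ++ u) ++_) eq) (sym (++-assoc (τ ++ u) pre (τ ++ post)))) ,
  trans (length-++ (τ ++ u)) (cong₂ _+_ (length-τu τ |u|≡m) |pre|)

module InterleavingFactorisation {S : Lang k} {m n j i : ℕ} (0<m : 0 < m)
  (S⊆ΣᵐΣⁿ : ⊆ΣmΣn m n S) (coprime : Coprime m n)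
  {τ : Word k} (|τ| : length τ ≡ n + j * m)
  {us : List (Word k)} (|us| : length us ≡ i) (|us|≡m : All (λ u → length u ≡ m) us)
  (1+i<m : suc i < m) where

  private
    W : Word k
    W = interleave τ us

    T : ℕ
    T = i * (n + j * m + m) + (n + j * m)

    |W| : length W ≡ T
    |W| = trans (length-interleave τ |us|≡m) (cong₂ (λ r ℓ → r * (ℓ + m) + ℓ) |us| |τ|)

    T≡ : T ≡ suc i * n + (suc i * j + i) * m
    T≡ = regroup i n j m
      where
      regroup : ∀ i n j m → i * (n + j * m + m) + (n + j * m) ≡ suc i * n + (suc i * j + i) * m
      regroup = solve-∀

    prefix≤T : ∀ p {v} → W ≡ p ++ v → length p ≤ T
    prefix≤T p {v} W≡pv = subst (length p ≤_) (trans (sym (length-++ p)) (trans (cong length (sym W≡pv)) |W|))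
      (m≤m+n (length p) (length v))

    offset : ∀ r q {ℓ} → ℓ ≡ r * (length τ + m) → r * n + (r * suc j + q) * m ≡ ℓ + q * m
    offset r q |pre| = trans (regroup r n j q m)
      (cong (_+ q * m) (trans (cong (λ ℓ → r * (ℓ + m)) (sym |τ|)) (sym |pre|)))
      where
      regroup : ∀ r n j q m → r * n + (r * suc j + q) * m ≡ r * (n + j * m + m) + q * m
      regroup = solve-∀

    aligned-factor-at : ∀ {p u w} r q → W ≡ p ++ u ++ w → length p ≡ r * n + (r * suc j + q) * m →
      r ≤ i → q ≤ j → length u ≡ n → S u → AlignedFactor S m τ
    aligned-factor-at {p} r q W≡puw |p| r≤i q≤j |u|≡n su
      with interleave-occurrence τ r (subst (r ≤_) (sym |us|) r≤i) |us|≡m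
    ... | pre , post , W≡pre·τ·post , |pre|
      with ++-equidivisible pre {zs = p} (subst (length pre ≤_) (sym (trans |p| (offset r q |pre|))) (m≤m+n _ _))
             (trans (sym W≡pre·τ·post) W≡puw)
    ... | a , refl , τ·post≡auw = aligned-factor {a = a} |τ| |a| q≤j |u|≡n su τ·post≡auw
      where
      |a| : length a ≡ q * m
      |a| = +-cancelˡ-≡ (length pre) (length a) (q * m)
        (trans (sym (length-++ pre)) (trans |p| (offset r q |pre|)))

    -- W ≡ p v has been read as r factors of length n and s of length m; s ≥ r (j + 1) means
    -- the next factor of length n starts no earlier than the (r + 1)-st copy of τ.
    factorise : ∀ {v} → Star S v → ∀ p r s → W ≡ p ++ v → length p ≡ r * n + s * m →
      r * suc j ≤ s → AlignedFactor S m τ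
    factorise ε p r s W≡p |p| r[1+j]≤s = contradiction 1+i≤r (≤⇒≯ r≤i)
      where
      |p|≡T : r * n + s * m ≡ T
      |p|≡T = trans (sym |p|) (trans (cong length (sym (trans W≡p (++-identityʳ p)))) |W|)
      r≤i : r ≤ i
      r≤i = few-long-factors 0<m r[1+j]≤s (≤-reflexive |p|≡T)
      1+i≤r : suc i ≤ r
      1+i≤r = coprime-coefficient-≤ {s = s} {c = suc i * j + i} coprime 1+i<m (trans |p|≡T T≡)
    factorise (_·_ {u} {w} su sw) p r s W≡p |p| r[1+j]≤s with S⊆ΣᵐΣⁿ u su
    ... | inj₁ |u|≡m =
      factorise sw (p ++ u) r (suc s) (trans W≡p (sym (++-assoc p u w)))
        (trans (length-++ p) (trans (cong₂ _+_ |p| |u|≡m) (regroup (r * n) s m))) (m≤n⇒m≤1+n r[1+j]≤s)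
      where
      regroup : ∀ rn s m → rn + s * m + m ≡ rn + suc s * m
      regroup = solve-∀
    ... | inj₂ |u|≡n with s ≤? r * suc j + j
    ...   | no s≰ =
      factorise sw (p ++ u) (suc r) s (trans W≡p (sym (++-assoc p u w)))
        (trans (length-++ p) (trans (cong₂ _+_ |p| |u|≡n) (regroup r n (s * m))))
        (subst (_≤ s) (cong suc (+-comm (r * suc j) j)) (≰⇒> s≰))
      where
      regroup : ∀ r n sm → r * n + sm + n ≡ suc r * n + sm
      regroup = solve-∀
    ...   | yes s≤ with m≤n⇒∃[o]m+o≡n r[1+j]≤s
    ...     | q , refl = aligned-factor-at {p} r q W≡p |p| r≤i (+-cancelˡ-≤ (r * suc j) q j s≤) |u|≡n su
      where
      r≤i : r ≤ i
      r≤i = few-long-factors 0<m r[1+j]≤s (subst (_≤ T) |p| (prefix≤T p W≡p))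

  Star-interleave⇒AlignedFactor : Star S (interleave τ us) → AlignedFactor S m τ
  Star-interleave⇒AlignedFactor W∈S* = factorise W∈S* [] 0 0 refl refl z≤n

lemma22 : (k : ℕ) → 1 ≤ k → (m n : ℕ) → 0 < m → m < n → n < 2 * m →
    (S : Lang k) → ⊆ΣmΣn m n S → CoFinite (Star S) →
    (τ : Word k) → ¬ Star S τ → (∃ λ j → length τ ≡ n + j * m) →
    (i : ℕ) → 1 ≤ i → i < m →
    (us : List (Word k)) → length us ≡ i ∸ 1 → All (λ u → length u ≡ m) us →
    ¬ Star S (interleave τ us)
lemma22 (suc k) (s≤s z≤n) m n 0<m m<n _ S S⊆ΣᵐΣⁿ S*-coFinite τ τ∉S* (j , |τ|)
        (suc i) (s≤s z≤n) 1+i<m us |us| |us|≡m W∈S* = τ∈S* τ∉S*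
  where
  open CoFiniteStar 0<m m<n S⊆ΣᵐΣⁿ S*-coFinite Data.Fin.zero
  open InterleavingFactorisation {j = j} 0<m S⊆ΣᵐΣⁿ coprime {τ} |τ| |us| |us|≡m 1+i<m

  τ∈S* : ¬ ¬ Star S τ
  τ∈S* = do
    let a , c , b , τ≡abc , m∣a , b∈S , m∣c = Star-interleave⇒AlignedFactor W∈S*
    a∈S* ← Σᵐ*⊆S* {a} m∣a
    c∈S* ← Σᵐ*⊆S* {c} m∣c
    pure (subst (Star S) (sym τ≡abc) (Star-++ a∈S* (b∈S · c∈S*)))
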